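{- For any integer $n \ge 2$, the double star graph $S_{1,n,n}$ (on $2n+1$ vertices) satisfies $\gamma(M(S_{1,n,n})) = n+1$.
   Context: The double star graph $S_{1,n,n}$ is obtained from the star $K_{1,n}$ by replacing every edge with a path of length $2$; i.e. it has vertices $v_0,v_1,\dots,v_{2n}$ and edges $v_0v_i$ and $v_iv_{n+i}$ for $1\le i\le n$. For a finite simple graph $H$, the middle graph $M(H)$ is the graph with vertex set $V(H)\cup E(H)$ in which two elements $x,y$ are adjacent if and only if either (1) $x,y\in E(H)$ and the edges $x,y$ share a common endpoint in $H$, or (2) $x\in V(H)$, $y\in E(H)$ and $x$ is an endpoint of $y$ (or vice versa). A dominating set of a graph $H$ is a set $S\subseteq V(H)$ such that every vertex of $H$ is in $S$ or adjacent to a vertex of $S$; the domination number $\gamma(H)$ is the minimum cardinality of a dominating set of $H$. -}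

module Defs where

open import Data.Bool using (Bool; true; false; _∧_; _∨_; T)
open import Data.Nat using (ℕ; zero; suc; _+_; _<_; _≤_)
open import Data.Nat.Base using (_≡ᵇ_)
import Data.Nat.Properties
open import Data.Fin using (Fin; toℕ)
open import Data.Product using (Σ; ∃; _×_; _,_)
open import Data.Sum using (_⊎_; inj₁; inj₂)
open import Data.Empty using (⊥)
open import Data.List using (List; length)
open import Data.List.Membership.Propositional using (_∈_)
open import Data.List.Relation.Unary.Unique.Propositional using (Unique)
open import Relation.Binary.PropositionalEquality using (_≡_; _≢_; refl)
open import Relation.Nullary using (¬_)

record Graph : Set₁ where
  field
    V   : Set
    Adj : V → V → Set
open Graph public

IsDominating : (G : Graph) → List (V G) → Set
IsDominating G S = ∀ v → v ∈ S ⊎ Σ (V G) (λ u → u ∈ S × Adj G u v)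

DominationNumberIs : (G : Graph) → ℕ → Set
DominationNumberIs G k =
  Σ (List (V G)) (λ S → Unique S × IsDominating G S × length S ≡ k)
  × (∀ (S : List (V G)) → Unique S → IsDominating G S → k ≤ length S)

record SimpleGraph (m : ℕ) : Set where
  field
    adj       : Fin m → Fin m → Bool
    adj-sym   : ∀ x y → adj x y ≡ adj y x
    adj-irrefl : ∀ x → adj x x ≡ false
open SimpleGraph public

-- Edges of H: unordered pairs {x,y}, represented canonically as (x , y)
-- with toℕ x < toℕ y and x adjacent to y.
Edge : ∀ {m} → SimpleGraph m → Set
Edge {m} H = Σ (Fin m) (λ x → Σ (Fin m) (λ y → toℕ x < toℕ y × T (adj H x y)))

IsEndpoint : ∀ {m} (H : SimpleGraph m) → Fin m → Edge H → Set
IsEndpoint H v (x , y , _) = v ≡ x ⊎ v ≡ y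

ShareEndpoint : ∀ {m} (H : SimpleGraph m) → Edge H → Edge H → Set
ShareEndpoint {m} H e f = Σ (Fin m) (λ v → IsEndpoint H v e × IsEndpoint H v f)

MiddleAdj : ∀ {m} (H : SimpleGraph m) → (Fin m ⊎ Edge H) → (Fin m ⊎ Edge H) → Set
MiddleAdj H (inj₁ x) (inj₁ y) = ⊥
MiddleAdj H (inj₁ x) (inj₂ e) = IsEndpoint H x e
MiddleAdj H (inj₂ e) (inj₁ x) = IsEndpoint H x e
MiddleAdj H (inj₂ e) (inj₂ f) = e ≢ f × ShareEndpoint H e f

Middle : ∀ {m} → SimpleGraph m → Graph
Middle {m} H = record { V = Fin m ⊎ Edge H ; Adj = MiddleAdj H }

-- Double star S_{1,n,n}: vertices v_0,…,v_{2n} (as Fin (2n+1), v_i = i),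
-- edges v_0 v_i and v_i v_{n+i} for 1 ≤ i ≤ n.

inRange : ℕ → ℕ → Bool
inRange n i = (1 Data.Nat.≤ᵇ i) ∧ (i Data.Nat.≤ᵇ n)

dsEdge : ℕ → ℕ → ℕ → Bool
dsEdge n a b = ((a ≡ᵇ 0) ∧ inRange n b) ∨ (inRange n a ∧ (b ≡ᵇ (n + a)))

dsAdjℕ : ℕ → ℕ → ℕ → Bool
dsAdjℕ n a b = dsEdge n a b ∨ dsEdge n b a

private
  ∨-false : ∀ b → b ≡ false → (b ∨ b) ≡ false
  ∨-false .false refl = refl

  ≡ᵇ-self-suc : ∀ k j → (k ≡ᵇ suc (j + k)) ≡ false
  ≡ᵇ-self-suc zero j = refl
  ≡ᵇ-self-suc (suc k) j rewrite Data.Nat.Properties.+-suc j k = ≡ᵇ-self-suc k j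

  ∧-false : ∀ b → (b ∧ false) ≡ false
  ∧-false true = refl
  ∧-false false = refl

  dsEdge-irrefl : ∀ n a → dsEdge n a a ≡ false
  dsEdge-irrefl n zero = refl
  dsEdge-irrefl zero (suc k) = refl
  dsEdge-irrefl (suc j) (suc k)
    rewrite Data.Nat.Properties.+-suc j k | ≡ᵇ-self-suc k j = ∧-false (inRange (suc j) (suc k))

  ∨-comm : ∀ a b → (a ∨ b) ≡ (b ∨ a)
  ∨-comm true true = refl
  ∨-comm true false = refl
  ∨-comm false true = refl
  ∨-comm false false = refl

DoubleStar : (n : ℕ) → SimpleGraph (suc (n + n))
DoubleStar n = record
  { adj        = λ x y → dsAdjℕ n (toℕ x) (toℕ y)
  ; adj-sym    = λ x y → ∨-comm (dsEdge n (toℕ x) (toℕ y)) (dsEdge n (toℕ y) (toℕ x))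
  ; adj-irrefl = λ x → ∨-false (dsEdge n (toℕ x) (toℕ x)) (dsEdge-irrefl n (toℕ x))
  }

module Submission where

-- Any one spoke v₀v_i together with the n legs v_i v_{n+i}
-- dominates the middle graph: every vertex of S_{1,n,n} is an endpoint
-- of a chosen edge, every leg is chosen, and each spoke v₀v_i shares the
-- endpoint v_i with the leg at v_i.
--
-- Label every element of M(H) by a
-- number: a vertex v_k by k ∸ n, an edge by the index of its smaller
-- endpoint.  For each label k ≤ n there is a vertex (v₀ for k = 0, the
-- tip v_{n+k} for k ≥ 1) whose closed neighbourhood carries only label k.
-- Hence every dominating set realises all n + 1 labels and so has at
-- least n + 1 elements.

open import Defs
open import Data.Nat using (ℕ; zero; suc; _+_; _∸_; _≤_; _<_; z≤n; s≤s; _≡ᵇ_)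
open import Data.Nat.Properties
open import Data.Bool using (T; _∧_)
open import Data.Bool.Properties using (T-∨; T-∧; T-irrelevant)
open import Data.Fin as Fin using (Fin; toℕ; fromℕ<)
open import Data.Fin.Properties using (toℕ-injective; toℕ-fromℕ<; toℕ<n)
open import Data.Product using (Σ; ∃; _×_; _,_; proj₁; proj₂)
open import Data.Sum using (_⊎_; inj₁; inj₂)
import Data.Sum as Sum
open import Data.Empty using (⊥-elim)
open import Data.Unit using (tt)
open import Data.List using (List; []; _∷_; length; map; upTo; allFin)
open import Data.List.Properties using (length-upTo; length-map; length-tabulate; length-removeAt′)
open import Data.List.Membership.Propositional using (_∈_)
open import Data.List.Membership.Propositional.Properties using (∈-map⁺; ∈-map⁻; ∈-upTo⁻; ∈-allFin)
open import Data.List.Relation.Binary.Subset.Propositional using (_⊆_)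
open import Data.List.Relation.Unary.Any using (here; there; index; _─_)
open import Data.List.Relation.Unary.All as All using ()
open import Data.List.Relation.Unary.AllPairs using (_∷_)
open import Data.List.Relation.Unary.Unique.Propositional using (Unique)
open import Data.List.Relation.Unary.Unique.Propositional.Properties using (upTo⁺; allFin⁺; map⁺)
open import Function using (_∘_)
open import Function.Bundles using (Equivalence)
open import Relation.Binary.PropositionalEquality
  using (_≡_; _≢_; refl; sym; trans; cong; cong₂; subst; subst₂; module ≡-Reasoning)
open import Relation.Nullary using (¬_; yes; no)

module _ {A : Set} where

  ∈-─ : ∀ {x z : A} {ys : List A} (x∈ys : x ∈ ys) → z ∈ ys → z ≢ x → z ∈ (ys ─ x∈ys)
  ∈-─ (here refl) (here refl) z≢x = ⊥-elim (z≢x refl)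
  ∈-─ (here refl) (there z∈ys) _  = z∈ys
  ∈-─ (there _)   (here refl) _   = here refl
  ∈-─ (there x∈ys) (there z∈ys) z≢x = there (∈-─ x∈ys z∈ys z≢x)

  unique-⊆⇒length≤ : ∀ {xs ys : List A} → Unique xs → xs ⊆ ys → length xs ≤ length ys
  unique-⊆⇒length≤ {[]} _ _ = z≤n
  unique-⊆⇒length≤ {x ∷ xs} {ys} (x∉xs ∷ xs-unique) xs⊆ys = begin
    suc (length xs)          ≤⟨ s≤s (unique-⊆⇒length≤ xs-unique xs⊆ys─x) ⟩
    suc (length (ys ─ x∈ys)) ≡⟨ sym (length-removeAt′ ys (index x∈ys)) ⟩
    length ys                ∎
    where
    open ≤-Reasoning
    x∈ys : x ∈ ys
    x∈ys = xs⊆ys (here refl)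
    xs⊆ys─x : xs ⊆ (ys ─ x∈ys)
    xs⊆ys─x z∈xs = ∈-─ x∈ys (xs⊆ys (there z∈xs)) (λ z≡x → All.lookup x∉xs z∈xs (sym z≡x))

module _ (G : Graph) where

  DominatedBy : List (V G) → V G → Set
  DominatedBy S v = v ∈ S ⊎ Σ (V G) (λ u → u ∈ S × Adj G u v)

  Certifies : (V G → ℕ) → ℕ → V G → Set
  Certifies label k w = label w ≡ k × (∀ u → Adj G u w → label u ≡ k)

  dominating-meets-label : ∀ (label : V G → ℕ) {k w} S →
    Certifies label k w → DominatedBy S w → k ∈ map label S
  dominating-meets-label label S (w-k , _) (inj₁ w∈S) = subst (_∈ map label S) w-k (∈-map⁺ label w∈S)
  dominating-meets-label label S (_ , nbr-k) (inj₂ (u , u∈S , u~w)) =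
    subst (_∈ map label S) (nbr-k u u~w) (∈-map⁺ label u∈S)

  certified-labels⇒lower-bound : ∀ (label : V G → ℕ) m →
    (∀ k → k < m → ∃ (Certifies label k)) → ∀ S → IsDominating G S → m ≤ length S
  certified-labels⇒lower-bound label m certified S dom = begin
    m                    ≡⟨ sym (length-upTo m) ⟩
    length (upTo m)      ≤⟨ unique-⊆⇒length≤ (upTo⁺ m) labels-realised ⟩
    length (map label S) ≡⟨ length-map label S ⟩
    length S             ∎
    where
    open ≤-Reasoning
    labels-realised : upTo m ⊆ map label S
    labels-realised {k} k∈upTo with certified k (∈-upTo⁻ k∈upTo)
    ... | w , cert = dominating-meets-label label S cert (dom w)

module _ (n : ℕ) where

  data EdgeShape : ℕ → ℕ → Set where
    spoke : (j : Fin n) → EdgeShape 0 (suc (toℕ j))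
    leg   : (j : Fin n) → EdgeShape (suc (toℕ j)) (n + suc (toℕ j))

  inner-index : ∀ {b} → 1 ≤ b → b ≤ n → Σ (Fin n) (λ j → suc (toℕ j) ≡ b)
  inner-index {suc b} _ b<n = fromℕ< b<n , cong suc (toℕ-fromℕ< b<n)

  T-inRange : ∀ b → T (inRange n b) → 1 ≤ b × b ≤ n
  T-inRange b t with Equivalence.to T-∧ t
  ... | 1≤b , b≤n = ≤ᵇ⇒≤ 1 b 1≤b , ≤ᵇ⇒≤ b n b≤n

  inRange-inner : (j : Fin n) → T (inRange n (suc (toℕ j)))
  inRange-inner j = Equivalence.from T-∧ (tt , ≤⇒≤ᵇ (toℕ<n j))

  dsEdge-shape : ∀ a b → T (dsEdge n a b) → EdgeShape a b
  dsEdge-shape a b t with Equivalence.to (T-∨ {(a ≡ᵇ 0) ∧ inRange n b}) t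
  ... | inj₁ centre-inner with Equivalence.to (T-∧ {a ≡ᵇ 0}) centre-inner
  ...   | a≡0 , b-inner with ≡ᵇ⇒≡ a 0 a≡0 | T-inRange b b-inner
  ...     | refl | 1≤b , b≤n with inner-index {b} 1≤b b≤n
  ...       | j , refl = spoke j
  dsEdge-shape a b t | inj₂ inner-tip with Equivalence.to (T-∧ {inRange n a}) inner-tip
  ...   | a-inner , b≡n+a with ≡ᵇ⇒≡ b (n + a) b≡n+a | T-inRange a a-inner
  ...     | refl | 1≤a , a≤n with inner-index {a} 1≤a a≤n
  ...       | j , refl = leg j

  shape-adjacent : ∀ {a b} → EdgeShape a b → T (dsAdjℕ n a b)
  shape-adjacent (spoke j) =
    Equivalence.from T-∨ (inj₁ (Equivalence.from T-∨ (inj₁ (Equivalence.from T-∧ (tt , inRange-inner j)))))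
  shape-adjacent (leg j) = Equivalence.from T-∨ (inj₁ (Equivalence.from
    (T-∨ {(suc (toℕ j) ≡ᵇ 0) ∧ inRange n (n + suc (toℕ j))})
    (inj₂ (Equivalence.from T-∧ (inRange-inner j , ≡⇒≡ᵇ (n + suc (toℕ j)) _ refl)))))

  shape-< : ∀ {a b} → EdgeShape a b → a < b
  shape-< (spoke j) = s≤s z≤n
  shape-< (leg j)   = m<n+m (suc (toℕ j)) (≤-<-trans z≤n (toℕ<n j))

  shape-bounded : ∀ {a b} → EdgeShape a b → b < suc (n + n)
  shape-bounded (spoke j) = s≤s (≤-trans (toℕ<n j) (m≤m+n n n))
  shape-bounded (leg j)   = s≤s (+-monoʳ-≤ n (toℕ<n j))

  centre-edge : ∀ {a b} → EdgeShape a b → 0 ≡ a ⊎ 0 ≡ b → a ≡ 0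
  centre-edge s (inj₁ 0≡a) = sym 0≡a
  centre-edge s (inj₂ 0≡b) = ⊥-elim (<⇒≱ (shape-< s) (subst (_≤ _) 0≡b z≤n))

  tip≰n : ∀ i → ¬ (n + suc i ≤ n)
  tip≰n i = <⇒≱ (m<m+n n (s≤s z≤n))

  tip-edge : ∀ {a b} i → EdgeShape a b → n + suc i ≡ a ⊎ n + suc i ≡ b → a ≡ suc i
  tip-edge i (spoke j) (inj₁ tip≡0) = ⊥-elim (0≢1+n (trans (sym tip≡0) (+-suc n i)))
  tip-edge i (spoke j) (inj₂ tip≡inner) = ⊥-elim (tip≰n i (subst (_≤ n) (sym tip≡inner) (toℕ<n j)))
  tip-edge i (leg j) (inj₁ tip≡inner)   = ⊥-elim (tip≰n i (subst (_≤ n) (sym tip≡inner) (toℕ<n j)))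
  tip-edge i (leg j) (inj₂ tip≡tip)     = sym (+-cancelˡ-≡ n _ _ tip≡tip)

  private
    H : SimpleGraph (suc (n + n))
    H = DoubleStar n

    M : Graph
    M = Middle H

  src : Edge H → ℕ
  src (x , _) = toℕ x

  tgt : Edge H → ℕ
  tgt (_ , y , _) = toℕ y

  shapeOf : (e : Edge H) → EdgeShape (src e) (tgt e)
  shapeOf (x , y , x<y , x~y) with Equivalence.to T-∨ x~y
  ... | inj₁ x→y = dsEdge-shape _ _ x→y
  ... | inj₂ y→x = ⊥-elim (<-asym x<y (shape-< (dsEdge-shape _ _ y→x)))

  edgeOf : ∀ {a b} → EdgeShape a b → Edge H
  edgeOf {a} {b} s =
    fromℕ< a<N , fromℕ< b<N ,
    subst₂ _<_ (sym (toℕ-fromℕ< a<N)) (sym (toℕ-fromℕ< b<N)) (shape-< s) ,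
    subst T (sym (cong₂ (dsAdjℕ n) (toℕ-fromℕ< a<N) (toℕ-fromℕ< b<N))) (shape-adjacent s)
    where
    b<N : b < suc (n + n)
    b<N = shape-bounded s
    a<N : a < suc (n + n)
    a<N = <-trans (shape-< s) b<N

  src-edgeOf : ∀ {a b} (s : EdgeShape a b) → src (edgeOf s) ≡ a
  src-edgeOf s = toℕ-fromℕ< _

  tgt-edgeOf : ∀ {a b} (s : EdgeShape a b) → tgt (edgeOf s) ≡ b
  tgt-edgeOf s = toℕ-fromℕ< _

  edge-≡ : ∀ (e f : Edge H) → src e ≡ src f → tgt e ≡ tgt f → e ≡ f
  edge-≡ (x , y , x<y , x~y) (x′ , y′ , x′<y′ , x′~y′) src≡ tgt≡
    with toℕ-injective src≡ | toℕ-injective tgt≡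
  ... | refl | refl = cong₂ (λ p q → x , y , p , q) (<-irrelevant x<y x′<y′) (T-irrelevant x~y x′~y′)

  legEdge : Fin n → Edge H
  legEdge j = edgeOf (leg j)

  data VertexView : ℕ → Set where
    centre : VertexView 0
    inner  : (j : Fin n) → VertexView (suc (toℕ j))
    tip    : (j : Fin n) → VertexView (n + suc (toℕ j))

  vertexView : ∀ k → k < suc (n + n) → VertexView k
  vertexView zero _ = centre
  vertexView (suc k) k<N with suc k ≤? n
  ... | yes 1+k≤n with inner-index {suc k} (s≤s z≤n) 1+k≤n
  ...   | j , refl = inner j
  vertexView (suc k) k<N | no 1+k≰n with m≤n⇒∃[o]m+o≡n (≤-pred (≰⇒> 1+k≰n))
  ...   | i , refl = subst VertexView tip-index (tip (fromℕ< i<n))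
    where
    i<n : i < n
    i<n = +-cancelˡ-< n i n (≤-pred k<N)
    tip-index : n + suc (toℕ (fromℕ< i<n)) ≡ suc (n + i)
    tip-index = trans (cong (λ t → n + suc t) (toℕ-fromℕ< i<n)) (+-suc n i)

  label : V M → ℕ
  label (inj₁ x) = toℕ x ∸ n
  label (inj₂ e) = src e

  spokeAndLegs : Fin n → List (V M)
  spokeAndLegs j₀ = inj₂ (edgeOf (spoke j₀)) ∷ map (inj₂ ∘ legEdge) (allFin n)

  leg∈spokeAndLegs : ∀ j₀ j → inj₂ (legEdge j) ∈ spokeAndLegs j₀
  leg∈spokeAndLegs j₀ j = there (∈-map⁺ (inj₂ ∘ legEdge) (∈-allFin j))

  spokeAndLegs-length : ∀ j₀ → length (spokeAndLegs j₀) ≡ n + 1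
  spokeAndLegs-length j₀ = begin
    suc (length (map (inj₂ ∘ legEdge) (allFin n))) ≡⟨ cong suc (length-map (inj₂ ∘ legEdge) (allFin n)) ⟩
    suc (length (allFin n))                        ≡⟨ cong suc (length-tabulate (λ j → j)) ⟩
    suc n                                          ≡⟨ +-comm 1 n ⟩
    n + 1                                          ∎
    where open ≡-Reasoning

  -- Distinct elements: the chosen edges have distinct smaller endpoints.
  spokeAndLegs-unique : ∀ j₀ → Unique (spokeAndLegs j₀)
  spokeAndLegs-unique j₀ =
    All.tabulate spoke≢leg ∷ map⁺ leg-injective (allFin⁺ n)
    where
    label-of-leg : ∀ j → label (inj₂ (legEdge j)) ≡ suc (toℕ j)
    label-of-leg j = src-edgeOf (leg j)
    leg-injective : ∀ {j j′} → inj₂ (legEdge j) ≡ inj₂ (legEdge j′) → j ≡ j′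
    leg-injective {j} {j′} leg≡leg = toℕ-injective (suc-injective
      (trans (sym (label-of-leg j)) (trans (cong label leg≡leg) (label-of-leg j′))))
    spoke≢leg : ∀ {u} → u ∈ map (inj₂ ∘ legEdge) (allFin n) → inj₂ (edgeOf (spoke j₀)) ≢ u
    spoke≢leg u∈legs spoke≡u with ∈-map⁻ (inj₂ ∘ legEdge) u∈legs
    ... | j , _ , refl =
      0≢1+n (trans (sym (src-edgeOf (spoke j₀))) (trans (cong label spoke≡u) (label-of-leg j)))

  vertex-dominated : ∀ j₀ (x : Fin (suc (n + n))) → DominatedBy M (spokeAndLegs j₀) (inj₁ x)
  vertex-dominated j₀ x = by-view (vertexView (toℕ x) (toℕ<n x)) refl
    where
    by-view : ∀ {k} → VertexView k → toℕ x ≡ k → DominatedBy M (spokeAndLegs j₀) (inj₁ x)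
    by-view centre x≡ = inj₂ (_ , here refl , inj₁ (toℕ-injective (trans x≡ (sym (src-edgeOf (spoke j₀))))))
    by-view (inner j) x≡ =
      inj₂ (_ , leg∈spokeAndLegs j₀ j , inj₁ (toℕ-injective (trans x≡ (sym (src-edgeOf (leg j))))))
    by-view (tip j) x≡ =
      inj₂ (_ , leg∈spokeAndLegs j₀ j , inj₂ (toℕ-injective (trans x≡ (sym (tgt-edgeOf (leg j))))))

  -- Legs are chosen; a spoke v₀ v_{1+j} meets the leg at v_{1+j}.
  edge-dominated : ∀ j₀ (e : Edge H) → DominatedBy M (spokeAndLegs j₀) (inj₂ e)
  edge-dominated j₀ e = by-shape (shapeOf e) refl refl
    where
    by-shape : ∀ {a b} → EdgeShape a b → src e ≡ a → tgt e ≡ b → DominatedBy M (spokeAndLegs j₀) (inj₂ e)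
    by-shape (spoke j) src≡0 tgt≡inner =
      inj₂ (inj₂ (legEdge j) , leg∈spokeAndLegs j₀ j , leg≢e ,
            proj₁ (proj₂ e) , inj₁ (toℕ-injective (trans tgt≡inner (sym (src-edgeOf (leg j))))) , inj₂ refl)
      where
      leg≢e : legEdge j ≢ e
      leg≢e leg≡e = 0≢1+n (trans (sym src≡0) (trans (cong src (sym leg≡e)) (src-edgeOf (leg j))))
    by-shape (leg j) src≡ tgt≡ =
      inj₁ (subst (λ f → inj₂ f ∈ spokeAndLegs j₀)
                  (edge-≡ (legEdge j) e (trans (src-edgeOf (leg j)) (sym src≡))
                                        (trans (tgt-edgeOf (leg j)) (sym tgt≡)))
                  (leg∈spokeAndLegs j₀ j))

  spokeAndLegs-dominating : ∀ j₀ → IsDominating M (spokeAndLegs j₀)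
  spokeAndLegs-dominating j₀ (inj₁ x) = vertex-dominated j₀ x
  spokeAndLegs-dominating j₀ (inj₂ e) = edge-dominated j₀ e

  -- v₀ certifies label 0: every edge at v₀ is a spoke starting at v₀.
  centre-certifies : Certifies M label 0 (inj₁ Fin.zero)
  centre-certifies = 0∸n≡0 n , at-centre
    where
    at-centre : ∀ u → Adj M u (inj₁ Fin.zero) → label u ≡ 0
    at-centre (inj₁ _) ()
    at-centre (inj₂ e) centre∈e = centre-edge (shapeOf e) (Sum.map (cong toℕ) (cong toℕ) centre∈e)

  tipVertex : ∀ i → i < n → Fin (suc (n + n))
  tipVertex i i<n = fromℕ< (s≤s (+-monoʳ-≤ n i<n))

  toℕ-tipVertex : ∀ i (i<n : i < n) → toℕ (tipVertex i i<n) ≡ n + suc i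
  toℕ-tipVertex i i<n = toℕ-fromℕ< _

  -- The tip v_{n+1+i} certifies label 1+i: its only edge is the leg at v_{1+i}.
  tip-certifies : ∀ i (i<n : i < n) → Certifies M label (suc i) (inj₁ (tipVertex i i<n))
  tip-certifies i i<n = trans (cong (_∸ n) (toℕ-tipVertex i i<n)) (m+n∸m≡n n (suc i)) , at-tip
    where
    tip-index : ∀ {x} → tipVertex i i<n ≡ x → n + suc i ≡ toℕ x
    tip-index tip≡x = trans (sym (toℕ-tipVertex i i<n)) (cong toℕ tip≡x)
    at-tip : ∀ u → Adj M u (inj₁ (tipVertex i i<n)) → label u ≡ suc i
    at-tip (inj₁ _) ()
    at-tip (inj₂ e) tip∈e = tip-edge i (shapeOf e) (Sum.map tip-index tip-index tip∈e)

  certified-labels : ∀ k → k < suc n → ∃ (Certifies M label k)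
  certified-labels zero    _         = _ , centre-certifies
  certified-labels (suc i) (s≤s i<n) = _ , tip-certifies i i<n

  dominating-set-lower-bound : ∀ S → IsDominating M S → n + 1 ≤ length S
  dominating-set-lower-bound S dom =
    subst (_≤ length S) (+-comm 1 n) (certified-labels⇒lower-bound M label (suc n) certified-labels S dom)

-- The argument only needs n ≥ 1, so that a spoke exists.
proposition3p6 : (n : ℕ) → 2 ≤ n → DominationNumberIs (Middle (DoubleStar n)) (n + 1)
proposition3p6 zero ()
proposition3p6 (suc m) _ =
  ( spokeAndLegs (suc m) Fin.zero
  , spokeAndLegs-unique (suc m) Fin.zero
  , spokeAndLegs-dominating (suc m) Fin.zero
  , spokeAndLegs-length (suc m) Fin.zero )
  , λ S _ dom → dominating-set-lower-bound (suc m) S dom
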